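{- Let $S\subseteq\mathcal{S}_d$, a partition $G_1,\dots,G_g$ of $[d]$, $\bar{\alpha},\bar{\beta}\in[0,1]^g$, and $k\in[d]$ be given. Consider the linear program in variables $x_{ij}$ ($i\in[d]$, $j\in[k]$) with constraints: (1) $\sum_{j\le k} x_{ij}\le 1$ for all $i\in[d]$; (2) $\sum_{i\in[d]} x_{ij}=1$ for all $j\le k$; (3) $\sum_{i\in G_a}\sum_{j\le k}x_{ij}\ge\lfloor\alpha_a k\rfloor$ for every group $G_a$; (4) $\sum_{i\in G_a}\sum_{j\le k}x_{ij}\le\lceil\beta_a k\rceil$ for every group $G_a$; (5) $0\le x_{ij}\le 1$ for all $i\in[d], j\le k$ (and any linear objective). If these constraints are expressed in standard form $A\bar{x}=\bar{b}$, $\bar{x}\ge 0$ (introducing a nonnegative slack variable for each inequality), then the matrix $A$ is totally unimodular.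
   Context: $\mathcal{S}_d$ denotes the set of permutations (rankings) of $[d]=\{1,\dots,d\}$. This LP is the linear relaxation of an integer program for fair top-$k$ rank aggregation, in which $x_{ij}=1$ means candidate $i$ is placed at position $j$. A matrix is totally unimodular if every square submatrix has determinant in $\{ -1,0,1\}$.
   Formalization: The vectors ᾱ and β̄ have rational entries in [0,1] rather than real ones. -}

module Defs where

open import Data.Nat as ℕ using (ℕ; zero; suc)
open import Data.Integer using (ℤ; +_; -_; _+_; _*_; 0ℤ; 1ℤ; -1ℤ)
open import Data.Fin using (Fin; zero; suc; splitAt; remQuot; punchIn; _≟_)
open import Data.Product using (_×_; _,_)
open import Data.Sum using (_⊎_; inj₁; inj₂)
open import Relation.Nullary using (does)
open import Data.Bool using (if_then_else_)
open import Relation.Binary.PropositionalEquality using (_≡_)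
open import Function.Definitions using (Injective)

Matrix : ℕ → ℕ → Set
Matrix m n = Fin m → Fin n → ℤ

sumℤ : ∀ {n} → (Fin n → ℤ) → ℤ
sumℤ {zero}  f = 0ℤ
sumℤ {suc n} f = f zero + sumℤ (λ j → f (suc j))

sgn : ∀ {n} → Fin n → ℤ
sgn zero    = 1ℤ
sgn (suc j) = - sgn j

det : ∀ n → Matrix n n → ℤ
det zero    M = 1ℤ
det (suc n) M =
  sumℤ (λ j → sgn j * (M zero j * det n (λ a b → M (suc a) (punchIn j b))))

submatrix : ∀ {m n r} → Matrix m n → (Fin r → Fin m) → (Fin r → Fin n) → Matrix r r
submatrix M f h a b = M (f a) (h b)

TotallyUnimodular : ∀ {m n} → Matrix m n → Set
TotallyUnimodular {m} {n} M =
  ∀ (r : ℕ) (f : Fin r → Fin m) (h : Fin r → Fin n) →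
  Injective _≡_ _≡_ f → Injective _≡_ _≡_ h →
  (det r (submatrix M f h) ≡ -1ℤ) ⊎ (det r (submatrix M f h) ≡ 0ℤ) ⊎ (det r (submatrix M f h) ≡ 1ℤ)

δ : ∀ {n} → Fin n → Fin n → ℤ
δ i i' = if does (i ≟ i') then 1ℤ else 0ℤ

-- Standard form of the fair top-k LP.
-- d candidates, k positions, g groups; grp i = index of the group containing i.
--
-- Columns (variables), in order:
--   x_{ij}  (d*k of them, index p ↦ remQuot k p = (i , j))
--   s_i     (d)   slack of (1):  Σ_j x_ij + s_i = 1
--   u_a     (g)   surplus of (3): Σ_{i∈G_a} Σ_j x_ij - u_a = ⌊α_a k⌋
--   v_a     (g)   slack of (4):  Σ_{i∈G_a} Σ_j x_ij + v_a = ⌈β_a k⌉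
--   t_{ij}  (d*k) slack of (5):  x_ij + t_ij = 1
-- Rows (constraints), in order: (1) d rows, (2) k rows, (3) g rows,
--   (4) g rows, (5) d*k rows (upper bounds x_ij ≤ 1).
-- Nonnegativity x ≥ 0 (and of all slacks) is the x̄ ≥ 0 part of standard form.

nRows : ℕ → ℕ → ℕ → ℕ
nRows d k g = d ℕ.+ (k ℕ.+ (g ℕ.+ (g ℕ.+ d ℕ.* k)))

nCols : ℕ → ℕ → ℕ → ℕ
nCols d k g = d ℕ.* k ℕ.+ (d ℕ.+ (g ℕ.+ (g ℕ.+ d ℕ.* k)))

data Col (d k g : ℕ) : Set where
  xC : Fin d → Fin k → Col d k g
  sC : Fin d → Col d k g
  uC : Fin g → Col d k g
  vC : Fin g → Col d k g
  tC : Fin (d ℕ.* k) → Col d k g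

decodeCol : ∀ d k g → Fin (nCols d k g) → Col d k g
decodeCol d k g c with splitAt (d ℕ.* k) c
... | inj₁ p with remQuot {d} k p
...   | (i , j) = xC i j
decodeCol d k g c | inj₂ c₁ with splitAt d c₁
... | inj₁ i = sC i
... | inj₂ c₂ with splitAt g c₂
...   | inj₁ a = uC a
...   | inj₂ c₃ with splitAt g c₃
...     | inj₁ a = vC a
...     | inj₂ p = tC p

data Row (d k g : ℕ) : Set where
  r1 : Fin d → Row d k g
  r2 : Fin k → Row d k g
  r3 : Fin g → Row d k g
  r4 : Fin g → Row d k g
  r5 : Fin (d ℕ.* k) → Row d k g

decodeRow : ∀ d k g → Fin (nRows d k g) → Row d k g
decodeRow d k g r with splitAt d r
... | inj₁ i = r1 i
... | inj₂ r₁ with splitAt k r₁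
...   | inj₁ j = r2 j
...   | inj₂ r₂ with splitAt g r₂
...     | inj₁ a = r3 a
...     | inj₂ r₃ with splitAt g r₃
...       | inj₁ a = r4 a
...       | inj₂ p = r5 p

entry : ∀ {d k g} → (Fin d → Fin g) → Row d k g → Col d k g → ℤ
entry grp (r1 i) (xC i' j') = δ i i'
entry grp (r1 i) (sC i')    = δ i i'
entry grp (r1 i) _          = 0ℤ
entry grp (r2 j) (xC i' j') = δ j j'
entry grp (r2 j) _          = 0ℤ
entry grp (r3 a) (xC i' j') = δ a (grp i')
entry grp (r3 a) (uC a')    = - δ a a'
entry grp (r3 a) _          = 0ℤ
entry grp (r4 a) (xC i' j') = δ a (grp i')
entry grp (r4 a) (vC a')    = δ a a'
entry grp (r4 a) _          = 0ℤ
entry {k = k} grp (r5 p) (xC i' j') = δ p (Data.Fin.combine i' j')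
entry grp (r5 p) (tC p')    = δ p p'
entry grp (r5 p) _          = 0ℤ

fairTopKMatrix : ∀ d k g → (Fin d → Fin g) → Matrix (nRows d k g) (nCols d k g)
fairTopKMatrix d k g grp r c = entry grp (decodeRow d k g r) (decodeCol d k g c)

module Submission where

-- Expanding along a slack column, or along a bound row x_ij + t_ij = 1 (which meets the
-- x-columns in a single entry), reduces every square submatrix of A to one of the x-part
-- of constraints (1)-(4), in which the two rows of a group coincide. There the candidate
-- rows refine the group rows; subtracting from each group row the rows of its candidates
-- that are present leaves a {0,1}-matrix in which every column has at most one nonzero
-- among candidate and group rows and at most one among position rows. Such a bipartite
-- incidence matrix has determinant in {-1,0,1}: a column with at most one nonzero entry
-- can be expanded along, and if every column has two, the position rows sum to the others.

open import Defs
open import Data.Nat using (ℕ; _≤_)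
open import Data.Fin using (Fin)
open import Data.Fin.Permutation using (Permutation′)
open import Data.Rational using (ℚ; 0ℚ; 1ℚ)
open import Data.Rational using () renaming (_≤_ to _≤ℚ_)
open import Data.Product using (∃)
open import Relation.Binary.PropositionalEquality using (_≡_)
open import Relation.Unary using (Pred)
open import Level using (0ℓ)

open import Data.Nat as ℕ using (ℕ; zero; suc)
open import Data.Integer using (ℤ; +_; -[1+_]; -_; _+_; _*_; 0ℤ; 1ℤ; -1ℤ)
import Data.Integer.Properties as ℤ
open import Data.Integer.Tactic.RingSolver using (solve-∀)
open import Algebra.Properties.Semiring.Sum ℤ.+-*-semiring
  using (sum; sum-cong-≗; sum-replicate-zero; ∑-distrib-+; ∑-comm; sum-remove; *-distribˡ-sum)
open import Data.Fin using (Fin; zero; suc; punchIn; punchOut; lift; combine; splitAt; _↑ˡ_; _↑ʳ_; _≟_)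
open import Data.Fin.Properties
  using (punchInᵢ≢i; punchIn-injective; punchIn-punchOut; punchOut-punchIn; punchOut-cong; any?;
         combine-injective; combine-remQuot; splitAt⁻¹-↑ˡ; splitAt⁻¹-↑ʳ)
open import Data.Product using (∃; _×_; _,_; proj₁; proj₂)
open import Data.Sum.Properties using (≡-dec)
open import Data.Bool using (Bool; true; false; if_then_else_)
open import Data.Sum using (_⊎_; inj₁; inj₂; [_,_]′)
open import Data.Empty using (⊥-elim)
open import Function using (_∘_; id; _⟨_⟩_; case_of_)
open import Function.Bundles using (mk⇔)
open import Data.Fin.Subset using (Subset; _∈_; _∉_; _∪_; ⁅_⁆; _⊃_) renaming (⊥ to ∅)
open import Data.Fin.Subset.Properties using (_∈?_; x∈p∪q⁻; x∈p∪q⁺; x∈⁅x⁆; x∈⁅y⁆⇒x≡y; p⊆p∪q; ∉⊥)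
open import Data.Fin.Subset.Induction using (⊃-wellFounded; Acc; acc)
open import Relation.Nullary using (Dec; yes; no; does; ¬_; ¬?)
open import Relation.Nullary.Decidable using (decidable-stable; _×-dec_; does-⇔; dec-true; dec-false)
open import Relation.Unary using (Pred; U; Decidable; _∩_)
open import Relation.Binary.Definitions using (DecidableEquality)
open import Function.Definitions using (Injective)
open import Relation.Binary.PropositionalEquality
  using (_≡_; _≢_; refl; sym; trans; cong; cong₂; subst; module ≡-Reasoning)

sumℤ≡sum : ∀ {n} (f : Fin n → ℤ) → sumℤ f ≡ sum f
sumℤ≡sum {zero}  f = refl
sumℤ≡sum {suc n} f = cong (_+_ (f zero)) (sumℤ≡sum (f ∘ suc))

sumℤ-cong : ∀ {n} {f h : Fin n → ℤ} → (∀ j → f j ≡ h j) → sumℤ f ≡ sumℤ h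
sumℤ-cong {f = f} {h} f≗h = trans (sumℤ≡sum f) (trans (sum-cong-≗ {x = f} {y = h} f≗h) (sym (sumℤ≡sum h)))

sumℤ-zero : ∀ {n} {f : Fin n → ℤ} → (∀ j → f j ≡ 0ℤ) → sumℤ f ≡ 0ℤ
sumℤ-zero {n} f≗0 = trans (sumℤ-cong {h = λ _ → 0ℤ} f≗0) (trans (sumℤ≡sum {n} (λ _ → 0ℤ)) (sum-replicate-zero n))

sumℤ-+ : ∀ {n} (f h : Fin n → ℤ) → sumℤ (λ j → f j + h j) ≡ sumℤ f + sumℤ h
sumℤ-+ f h = begin
  sumℤ (λ j → f j + h j) ≡⟨ sumℤ≡sum (λ j → f j + h j) ⟩
  sum (λ j → f j + h j)  ≡⟨ ∑-distrib-+ f h ⟩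
  sum f + sum h          ≡⟨ sym (cong₂ _+_ (sumℤ≡sum f) (sumℤ≡sum h)) ⟩
  sumℤ f + sumℤ h        ∎
  where open ≡-Reasoning

sumℤ-* : ∀ {n} (c : ℤ) (f : Fin n → ℤ) → sumℤ (λ j → c * f j) ≡ c * sumℤ f
sumℤ-* c f = begin
  sumℤ (λ j → c * f j) ≡⟨ sumℤ≡sum (λ j → c * f j) ⟩
  sum (λ j → c * f j)  ≡⟨ sym (*-distribˡ-sum c f) ⟩
  c * sum f            ≡⟨ cong (c *_) (sym (sumℤ≡sum f)) ⟩
  c * sumℤ f           ∎
  where open ≡-Reasoning

sumℤ-neg : ∀ {n} (f : Fin n → ℤ) → sumℤ (λ j → - f j) ≡ - sumℤ f
sumℤ-neg f = begin
  sumℤ (λ j → - f j)     ≡⟨ sumℤ-cong (λ j → sym (ℤ.-1*i≡-i (f j))) ⟩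
  sumℤ (λ j → -1ℤ * f j) ≡⟨ sumℤ-* -1ℤ f ⟩
  -1ℤ * sumℤ f           ≡⟨ ℤ.-1*i≡-i (sumℤ f) ⟩
  - sumℤ f               ∎
  where open ≡-Reasoning

sumℤ-comm : ∀ {m n} (F : Fin m → Fin n → ℤ) →
           sumℤ (λ i → sumℤ (F i)) ≡ sumℤ (λ j → sumℤ (λ i → F i j))
sumℤ-comm F = begin
  sumℤ (λ i → sumℤ (F i))           ≡⟨ sumℤ-cong (λ i → sumℤ≡sum (F i)) ⟩
  sumℤ (λ i → sum (F i))            ≡⟨ sumℤ≡sum (λ i → sum (F i)) ⟩
  sum (λ i → sum (F i))             ≡⟨ ∑-comm F ⟩
  sum (λ j → sum (λ i → F i j))     ≡⟨ sym (sumℤ≡sum (λ j → sum (λ i → F i j))) ⟩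
  sumℤ (λ j → sum (λ i → F i j))    ≡⟨ sumℤ-cong (λ j → sym (sumℤ≡sum (λ i → F i j))) ⟩
  sumℤ (λ j → sumℤ (λ i → F i j))   ∎
  where open ≡-Reasoning

sumℤ-remove : ∀ {n} (f : Fin (suc n) → ℤ) (i : Fin (suc n)) → sumℤ f ≡ f i + sumℤ (f ∘ punchIn i)
sumℤ-remove f i = begin
  sumℤ f                   ≡⟨ sumℤ≡sum f ⟩
  sum f                    ≡⟨ sum-remove {i = i} f ⟩
  f i + sum (f ∘ punchIn i) ≡⟨ cong (_+_ (f i)) (sym (sumℤ≡sum (f ∘ punchIn i))) ⟩
  f i + sumℤ (f ∘ punchIn i) ∎
  where open ≡-Reasoning

sumℤ-single : ∀ {n} (f : Fin n → ℤ) (i : Fin n) → (∀ j → j ≢ i → f j ≡ 0ℤ) → sumℤ f ≡ f i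
sumℤ-single {suc n} f i others = begin
  sumℤ f                     ≡⟨ sumℤ-remove f i ⟩
  f i + sumℤ (f ∘ punchIn i) ≡⟨ cong (_+_ (f i)) (sumℤ-zero (λ j → others (punchIn i j) (punchInᵢ≢i i j))) ⟩
  f i + 0ℤ                   ≡⟨ ℤ.+-identityʳ (f i) ⟩
  f i                        ∎
  where open ≡-Reasoning

sumℤ-dropZero : ∀ {n} (f : Fin (suc n) → ℤ) (i : Fin (suc n)) → f i ≡ 0ℤ → sumℤ f ≡ sumℤ (f ∘ punchIn i)
sumℤ-dropZero f i fi≡0 = begin
  sumℤ f                     ≡⟨ sumℤ-remove f i ⟩
  f i + sumℤ (f ∘ punchIn i) ≡⟨ cong (_+ sumℤ (f ∘ punchIn i)) fi≡0 ⟩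
  0ℤ + sumℤ (f ∘ punchIn i)  ≡⟨ ℤ.+-identityˡ _ ⟩
  sumℤ (f ∘ punchIn i)       ∎
  where open ≡-Reasoning

sumℤ-pair : ∀ {n} (f : Fin n → ℤ) {i j : Fin n} → i ≢ j →
            (∀ l → l ≢ i → l ≢ j → f l ≡ 0ℤ) → sumℤ f ≡ f i + f j
sumℤ-pair {suc n} f {i} {j} i≢j others = begin
  sumℤ f                           ≡⟨ sumℤ-remove f i ⟩
  f i + sumℤ (f ∘ punchIn i)       ≡⟨ cong (_+_ (f i)) (sumℤ-single (f ∘ punchIn i) (punchOut i≢j) rest≡0) ⟩
  f i + f (punchIn i (punchOut i≢j)) ≡⟨ cong (λ l → f i + f l) (punchIn-punchOut i≢j) ⟩
  f i + f j                        ∎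
  where
  open ≡-Reasoning
  rest≡0 : ∀ l → l ≢ punchOut i≢j → f (punchIn i l) ≡ 0ℤ
  rest≡0 l l≢ = others (punchIn i l) (punchInᵢ≢i i l)
    (λ eq → l≢ (punchIn-injective i l _ (trans eq (sym (punchIn-punchOut i≢j)))))

-- Determinants

sgn*sgn≡1 : ∀ {n} (j : Fin n) → sgn j * sgn j ≡ 1ℤ
sgn*sgn≡1 zero    = refl
sgn*sgn≡1 (suc j) = trans (neg*neg (sgn j)) (sgn*sgn≡1 j)
  where
  neg*neg : ∀ x → (- x) * (- x) ≡ x * x
  neg*neg = solve-∀

sgn*sgn*x≡x : ∀ {n} (j : Fin n) (x : ℤ) → sgn j * (sgn j * x) ≡ x
sgn*sgn*x≡x j x = begin
  sgn j * (sgn j * x) ≡⟨ sym (ℤ.*-assoc (sgn j) (sgn j) x) ⟩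
  sgn j * sgn j * x   ≡⟨ cong (_* x) (sgn*sgn≡1 j) ⟩
  1ℤ * x              ≡⟨ ℤ.*-identityˡ x ⟩
  x                   ∎
  where open ≡-Reasoning

sgn*x≡y⇒x≡sgn*y : ∀ {n} (j : Fin n) {x y : ℤ} → sgn j * x ≡ y → x ≡ sgn j * y
sgn*x≡y⇒x≡sgn*y j {x} eq = trans (sym (sgn*sgn*x≡x j x)) (cong (sgn j *_) eq)

det-cong : ∀ n {M N : Matrix n n} → (∀ a b → M a b ≡ N a b) → det n M ≡ det n N
det-cong zero    _   = refl
det-cong (suc n) M≗N = sumℤ-cong λ j →
  cong₂ (λ x y → sgn j * (x * y)) (M≗N zero j) (det-cong n (λ a b → M≗N (suc a) (punchIn j b)))

minor : ∀ {n} → Matrix (suc n) (suc n) → Fin (suc n) → Fin (suc n) → Matrix n n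
minor M p b a b′ = M (punchIn p a) (punchIn b b′)

sgn-punchOut-antisym : ∀ {n} {j k : Fin (suc (suc n))} (j≢k : j ≢ k) (k≢j : k ≢ j) →
                       sgn j * sgn (punchOut j≢k) ≡ - (sgn k * sgn (punchOut k≢j))
sgn-punchOut-antisym {j = zero}  {zero}  j≢k _ = ⊥-elim (j≢k refl)
sgn-punchOut-antisym {j = zero}  {suc k} _   _ = eq (sgn k)
  where
  eq : ∀ x → 1ℤ * x ≡ - ((- x) * 1ℤ)
  eq = solve-∀
sgn-punchOut-antisym {j = suc j} {zero}  _   _ = eq (sgn j)
  where
  eq : ∀ x → (- x) * 1ℤ ≡ - (1ℤ * x)
  eq = solve-∀
sgn-punchOut-antisym {zero}  {suc zero} {suc zero} j≢k _ = ⊥-elim (j≢k refl)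
sgn-punchOut-antisym {suc n} {suc j} {suc k} j≢k k≢j =
  trans (neg*neg (sgn j) _)
    (trans (sgn-punchOut-antisym (j≢k ∘ cong suc) (k≢j ∘ cong suc)) (cong -_ (sym (neg*neg (sgn k) _))))
  where
  neg*neg : ∀ x y → (- x) * (- y) ≡ x * y
  neg*neg = solve-∀

punchIn-punchOut-comm : ∀ {n} {j k : Fin (suc (suc n))} (j≢k : j ≢ k) (k≢j : k ≢ j) (b : Fin n) →
                        punchIn j (punchIn (punchOut j≢k) b) ≡ punchIn k (punchIn (punchOut k≢j) b)
punchIn-punchOut-comm {j = zero}  {zero}  j≢k _ _ = ⊥-elim (j≢k refl)
punchIn-punchOut-comm {j = zero}  {suc k} _   _ _ = refl
punchIn-punchOut-comm {j = suc j} {zero}  _   _ _ = refl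
punchIn-punchOut-comm {zero}  {suc zero} {suc zero} j≢k _ _ = ⊥-elim (j≢k refl)
punchIn-punchOut-comm {suc n} {suc j} {suc k} _ _ zero = refl
punchIn-punchOut-comm {suc n} {suc j} {suc k} j≢k k≢j (suc b) =
  cong suc (punchIn-punchOut-comm (j≢k ∘ cong suc) (k≢j ∘ cong suc) b)

punchOut-punchIn′ : ∀ {n} (j : Fin (suc n)) {l : Fin n} (j≢ : j ≢ punchIn j l) → punchOut j≢ ≡ l
punchOut-punchIn′ j j≢ = trans (punchOut-cong j refl) (punchOut-punchIn j)

-- term u v j k is the summand of the Laplace expansion along two rows u, v that takes u from
-- column j and v from column k; it is antisymmetric, so exchanging the rows negates det.
module TwoRowExpansion {n} (R : Fin n → Fin (suc (suc n)) → ℤ) where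

  withoutColumns : ∀ {j k} → j ≢ k → ℤ
  withoutColumns {j} j≢k = det n (λ a b → R a (punchIn j (punchIn (punchOut j≢k) b)))

  term : (u v : Fin (suc (suc n)) → ℤ) → Fin (suc (suc n)) → Fin (suc (suc n)) → ℤ
  term u v j k with j ≟ k
  ... | yes _   = 0ℤ
  ... | no j≢k = sgn j * (sgn (punchOut j≢k) * (u j * (v k * withoutColumns j≢k)))

  term-diag : ∀ u v j → term u v j j ≡ 0ℤ
  term-diag u v j with j ≟ j
  ... | yes _   = refl
  ... | no j≢j = ⊥-elim (j≢j refl)

  term-punchIn : ∀ u v j l → term u v j (punchIn j l) ≡
    sgn j * (u j * (sgn l * (v (punchIn j l) * det n (λ a b → R a (punchIn j (punchIn l b))))))
  term-punchIn u v j l with j ≟ punchIn j l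
  ... | yes j≡ = ⊥-elim (punchInᵢ≢i j l (sym j≡))
  ... | no j≢ rewrite punchOut-punchIn′ j j≢ = reorder (sgn j) (sgn l) (u j) (v (punchIn j l)) _
    where
    reorder : ∀ s t x y z → s * (t * (x * (y * z))) ≡ s * (x * (t * (y * z)))
    reorder = solve-∀

  term-antisym : ∀ u v j k → term v u j k ≡ - term u v k j
  term-antisym u v j k with j ≟ k | k ≟ j
  ... | yes _   | yes _   = refl
  ... | yes j≡k | no k≢j = ⊥-elim (k≢j (sym j≡k))
  ... | no j≢k  | yes k≡j = ⊥-elim (j≢k (sym k≡j))
  ... | no j≢k  | no k≢j = begin
    sgn j * (sgn (punchOut j≢k) * (v j * (u k * withoutColumns j≢k)))
      ≡⟨ cong (λ z → sgn j * (sgn (punchOut j≢k) * (v j * (u k * z))))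
              (det-cong n (λ a b → cong (R a) (punchIn-punchOut-comm j≢k k≢j b))) ⟩
    sgn j * (sgn (punchOut j≢k) * (v j * (u k * w)))
      ≡⟨ sym (ℤ.*-assoc (sgn j) _ _) ⟩
    sgn j * sgn (punchOut j≢k) * (v j * (u k * w))
      ≡⟨ cong (_* (v j * (u k * w))) (sgn-punchOut-antisym j≢k k≢j) ⟩
    - (sgn k * sgn (punchOut k≢j)) * (v j * (u k * w))
      ≡⟨ reorder (sgn k) (sgn (punchOut k≢j)) (v j) (u k) w ⟩
    - (sgn k * (sgn (punchOut k≢j) * (u k * (v j * w)))) ∎
    where
    open ≡-Reasoning
    w = withoutColumns k≢j
    reorder : ∀ s t x y z → - (s * t) * (x * (y * z)) ≡ - (s * (t * (y * (x * z))))
    reorder = solve-∀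

det-twoRows : ∀ {n} (M : Matrix (suc (suc n)) (suc (suc n))) →
              det (suc (suc n)) M ≡ sumℤ (λ j → sumℤ (TwoRowExpansion.term (λ a → M (suc (suc a))) (M zero) (M (suc zero)) j))
det-twoRows {n} M = sumℤ-cong λ j → begin
  sgn j * (M zero j * sumℤ (X j))           ≡⟨ cong (sgn j *_) (sym (sumℤ-* (M zero j) (X j))) ⟩
  sgn j * sumℤ (λ l → M zero j * X j l)     ≡⟨ sym (sumℤ-* (sgn j) (λ l → M zero j * X j l)) ⟩
  sumℤ (λ l → sgn j * (M zero j * X j l))   ≡⟨ sumℤ-cong (λ l → sym (term-punchIn (M zero) (M (suc zero)) j l)) ⟩
  sumℤ (term (M zero) (M (suc zero)) j ∘ punchIn j)
    ≡⟨ sym (sumℤ-dropZero (term (M zero) (M (suc zero)) j) j (term-diag (M zero) (M (suc zero)) j)) ⟩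
  sumℤ (term (M zero) (M (suc zero)) j)     ∎
  where
  open ≡-Reasoning
  open TwoRowExpansion (λ a → M (suc (suc a)))
  X : Fin (suc (suc n)) → Fin (suc n) → ℤ
  X j l = sgn l * (M (suc zero) (punchIn j l) * det n (λ a b → M (suc (suc a)) (punchIn j (punchIn l b))))

swap01 : ∀ {n} → Fin (suc (suc n)) → Fin (suc (suc n))
swap01 zero          = suc zero
swap01 (suc zero)    = zero
swap01 (suc (suc a)) = suc (suc a)

det-swap01 : ∀ {n} (M : Matrix (suc (suc n)) (suc (suc n))) → det (suc (suc n)) (M ∘ swap01) ≡ - det (suc (suc n)) M
det-swap01 M = begin
  det _ (M ∘ swap01)                         ≡⟨ det-twoRows (M ∘ swap01) ⟩
  sumℤ (λ j → sumℤ (λ k → term v u j k))    ≡⟨ sumℤ-comm (term v u) ⟩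
  sumℤ (λ k → sumℤ (λ j → term v u j k))    ≡⟨ sumℤ-cong (λ k → sumℤ-cong (λ j → term-antisym u v j k)) ⟩
  sumℤ (λ k → sumℤ (λ j → - term u v k j))  ≡⟨ sumℤ-cong (λ k → sumℤ-neg (term u v k)) ⟩
  sumℤ (λ k → - sumℤ (term u v k))          ≡⟨ sumℤ-neg (λ k → sumℤ (term u v k)) ⟩
  - sumℤ (λ k → sumℤ (term u v k))          ≡⟨ cong -_ (sym (det-twoRows M)) ⟩
  - det _ M                                  ∎
  where
  open ≡-Reasoning
  open TwoRowExpansion (λ a → M (suc (suc a)))
  u = M zero
  v = M (suc zero)

x≡-x⇒x≡0 : ∀ {x : ℤ} → x ≡ - x → x ≡ 0ℤ
x≡-x⇒x≡0 {+ zero}    _  = refl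
x≡-x⇒x≡0 {+ suc _}   ()
x≡-x⇒x≡0 { -[1+ _ ]} ()

moveToTop : ∀ {n} → Fin (suc n) → Fin (suc n) → Fin (suc n)
moveToTop p zero    = p
moveToTop p (suc a) = punchIn p a

det-permuteLowerRows : ∀ {n} (M : Matrix (suc n) (suc n)) (σ : Fin n → Fin n) (s : ℤ) →
                       (∀ j → det n (minor M zero j ∘ σ) ≡ s * det n (minor M zero j)) →
                       det (suc n) (M ∘ lift 1 σ) ≡ s * det (suc n) M
det-permuteLowerRows {n} M σ s minors = begin
  sumℤ (λ j → sgn j * (M zero j * det n (minor M zero j ∘ σ)))
    ≡⟨ sumℤ-cong (λ j → cong (λ z → sgn j * (M zero j * z)) (minors j)) ⟩
  sumℤ (λ j → sgn j * (M zero j * (s * D j)))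
    ≡⟨ sumℤ-cong (λ j → pull (sgn j) (M zero j) s (D j)) ⟩
  sumℤ (λ j → s * (sgn j * (M zero j * D j)))
    ≡⟨ sumℤ-* s (λ j → sgn j * (M zero j * D j)) ⟩
  s * det (suc n) M ∎
  where
  open ≡-Reasoning
  D : Fin (suc n) → ℤ
  D j = det n (minor M zero j)
  pull : ∀ t x s d → t * (x * (s * d)) ≡ s * (t * (x * d))
  pull = solve-∀

det-moveToTop : ∀ n (M : Matrix (suc n) (suc n)) p → det (suc n) (M ∘ moveToTop p) ≡ sgn p * det (suc n) M
det-moveToTop n M zero = trans (det-cong (suc n) unchanged) (sym (ℤ.*-identityˡ _))
  where
  unchanged : ∀ a b → M (moveToTop zero a) b ≡ M a b
  unchanged zero    b = refl
  unchanged (suc a) b = refl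
det-moveToTop (suc m) M (suc p) = begin
  det _ (M ∘ moveToTop (suc p))          ≡⟨ det-cong _ viaSwap ⟩
  det _ (N ∘ swap01)                     ≡⟨ det-swap01 N ⟩
  - det _ N                              ≡⟨ cong -_ (det-permuteLowerRows M (moveToTop p) (sgn p) minors) ⟩
  - (sgn p * det _ M)                    ≡⟨ ℤ.neg-distribˡ-* (sgn p) _ ⟩
  - sgn p * det _ M                      ∎
  where
  open ≡-Reasoning
  N : Matrix (suc (suc m)) (suc (suc m))
  N = M ∘ lift 1 (moveToTop p)
  minors : ∀ j → det (suc m) (minor M zero j ∘ moveToTop p) ≡ sgn p * det (suc m) (minor M zero j)
  minors j = det-moveToTop m (minor M zero j) p
  viaSwap : ∀ a b → M (moveToTop (suc p) a) b ≡ N (swap01 a) b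
  viaSwap zero          b = refl
  viaSwap (suc zero)    b = refl
  viaSwap (suc (suc a)) b = refl

det-topRowRepeated : ∀ n (M : Matrix (suc (suc n)) (suc (suc n))) (a : Fin (suc n)) →
                     (∀ b → M zero b ≡ M (suc a) b) → det (suc (suc n)) M ≡ 0ℤ
det-topRowRepeated n M a top≡a = begin
  det _ M             ≡⟨ sgn*x≡y⇒x≡sgn*y a (sym (det-permuteLowerRows M (moveToTop a) (sgn a) minors)) ⟩
  sgn a * det _ N     ≡⟨ cong (sgn a *_) (x≡-x⇒x≡0 (trans (sym (det-cong _ swapFixes)) (det-swap01 N))) ⟩
  sgn a * 0ℤ          ≡⟨ ℤ.*-zeroʳ (sgn a) ⟩
  0ℤ                  ∎
  where
  open ≡-Reasoning
  N : Matrix (suc (suc n)) (suc (suc n))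
  N = M ∘ lift 1 (moveToTop a)
  minors : ∀ j → det (suc n) (minor M zero j ∘ moveToTop a) ≡ sgn a * det (suc n) (minor M zero j)
  minors j = det-moveToTop n (minor M zero j) a
  swapFixes : ∀ x b → N (swap01 x) b ≡ N x b
  swapFixes zero          b = sym (top≡a b)
  swapFixes (suc zero)    b = top≡a b
  swapFixes (suc (suc x)) b = refl

det-equalRows : ∀ n (M : Matrix n n) {p q : Fin n} → p ≢ q → (∀ b → M p b ≡ M q b) → det n M ≡ 0ℤ
det-equalRows (suc zero)    M {zero} {zero} p≢q _ = ⊥-elim (p≢q refl)
det-equalRows (suc (suc m)) M {p}    {q}    p≢q p≡q = begin
  det _ M                   ≡⟨ sgn*x≡y⇒x≡sgn*y p (sym (det-moveToTop (suc m) M p)) ⟩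
  sgn p * det _ (M ∘ moveToTop p) ≡⟨ cong (sgn p *_) (det-topRowRepeated m (M ∘ moveToTop p) (punchOut p≢q) top≡q) ⟩
  sgn p * 0ℤ                ≡⟨ ℤ.*-zeroʳ (sgn p) ⟩
  0ℤ                        ∎
  where
  open ≡-Reasoning
  top≡q : ∀ b → M p b ≡ M (punchIn p (punchOut p≢q)) b
  top≡q b = trans (p≡q b) (cong (λ r → M r b) (sym (punchIn-punchOut p≢q)))

s*[x*0]≡0 : ∀ s x → s * (x * 0ℤ) ≡ 0ℤ
s*[x*0]≡0 s x = trans (cong (s *_) (ℤ.*-zeroʳ x)) (ℤ.*-zeroʳ s)

minor-zeroColumn : ∀ {n} (M : Matrix (suc n) (suc n)) p {c j} (j≢c : j ≢ c) →
                   (∀ a → a ≢ p → M a c ≡ 0ℤ) → ∀ a → minor M p j a (punchOut j≢c) ≡ 0ℤ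
minor-zeroColumn M p j≢c column≡0 a =
  trans (cong (M (punchIn p a)) (punchIn-punchOut j≢c)) (column≡0 (punchIn p a) (punchInᵢ≢i p a))

det-zeroColumn : ∀ n (M : Matrix n n) c → (∀ a → M a c ≡ 0ℤ) → det n M ≡ 0ℤ
det-zeroColumn (suc n) M c column≡0 = sumℤ-zero term≡0
  where
  term≡0 : ∀ j → sgn j * (M zero j * det n (minor M zero j)) ≡ 0ℤ
  term≡0 j with j ≟ c
  ... | yes refl = cong (λ x → sgn j * (x * det n (minor M zero j))) (column≡0 zero)
                   ⟨ trans ⟩ ℤ.*-zeroʳ (sgn j)
  ... | no j≢c  = cong (λ z → sgn j * (M zero j * z))
                       (det-zeroColumn n _ _ (minor-zeroColumn M zero j≢c (λ a _ → column≡0 a)))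
                   ⟨ trans ⟩ s*[x*0]≡0 (sgn j) (M zero j)

det-laplaceRow : ∀ n (M : Matrix (suc n) (suc n)) p →
                 det (suc n) M ≡ sgn p * sumℤ (λ j → sgn j * (M p j * det n (minor M p j)))
det-laplaceRow n M p = sgn*x≡y⇒x≡sgn*y p (sym (det-moveToTop n M p))

det-expandRow : ∀ n (M : Matrix (suc n) (suc n)) p c → (∀ b → b ≢ c → M p b ≡ 0ℤ) →
                det (suc n) M ≡ sgn p * (sgn c * (M p c * det n (minor M p c)))
det-expandRow n M p c row≡0 = trans (det-laplaceRow n M p) (cong (sgn p *_) (sumℤ-single _ c term≡0))
  where
  term≡0 : ∀ j → j ≢ c → sgn j * (M p j * det n (minor M p j)) ≡ 0ℤ
  term≡0 j j≢c = trans (cong (λ x → sgn j * (x * det n (minor M p j))) (row≡0 j j≢c)) (ℤ.*-zeroʳ (sgn j))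

det-expandColumn : ∀ n (M : Matrix (suc n) (suc n)) p c → (∀ a → a ≢ p → M a c ≡ 0ℤ) →
                   det (suc n) M ≡ sgn p * (sgn c * (M p c * det n (minor M p c)))
det-expandColumn n M p c column≡0 = trans (det-laplaceRow n M p) (cong (sgn p *_) (sumℤ-single _ c term≡0))
  where
  term≡0 : ∀ j → j ≢ c → sgn j * (M p j * det n (minor M p j)) ≡ 0ℤ
  term≡0 j j≢c = trans (cong (λ z → sgn j * (M p j * z)) (det-zeroColumn n _ _ (minor-zeroColumn M p j≢c column≡0)))
                       (s*[x*0]≡0 (sgn j) (M p j))

withTopRow : ∀ {n} → Matrix (suc n) (suc n) → (Fin (suc n) → ℤ) → Matrix (suc n) (suc n)
withTopRow M r zero    = r
withTopRow M r (suc a) = M (suc a)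

det-withTopRow-0 : ∀ n (M : Matrix (suc n) (suc n)) → det (suc n) (withTopRow M (λ _ → 0ℤ)) ≡ 0ℤ
det-withTopRow-0 n M = sumℤ-zero {suc n} (λ j → ℤ.*-zeroʳ (sgn j))

det-withTopRow-+ : ∀ n (M : Matrix (suc n) (suc n)) (r s : Fin (suc n) → ℤ) →
                   det (suc n) (withTopRow M (λ b → r b + s b)) ≡ det (suc n) (withTopRow M r) + det (suc n) (withTopRow M s)
det-withTopRow-+ n M r s = trans (sumℤ-cong (λ j → distrib (sgn j) (r j) (s j) (D j)))
                                 (sumℤ-+ (λ j → sgn j * (r j * D j)) (λ j → sgn j * (s j * D j)))
  where
  D : Fin (suc n) → ℤ
  D j = det n (minor M zero j)
  distrib : ∀ t x y d → t * ((x + y) * d) ≡ t * (x * d) + t * (y * d)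
  distrib = solve-∀

det-withTopRow-* : ∀ n (M : Matrix (suc n) (suc n)) (c : ℤ) (r : Fin (suc n) → ℤ) →
                   det (suc n) (withTopRow M (λ b → c * r b)) ≡ c * det (suc n) (withTopRow M r)
det-withTopRow-* n M c r = trans (sumℤ-cong (λ j → pull (sgn j) c (r j) (det n (minor M zero j))))
                                 (sumℤ-* c (λ j → sgn j * (r j * det n (minor M zero j))))
  where
  pull : ∀ t c x d → t * ((c * x) * d) ≡ c * (t * (x * d))
  pull = solve-∀

det-withTopRow-sum : ∀ n (M : Matrix (suc n) (suc n)) {m} (w : Fin m → ℤ) (R : Fin m → Fin (suc n) → ℤ) →
                     det (suc n) (withTopRow M (λ b → sumℤ (λ a → w a * R a b))) ≡
                     sumℤ (λ a → w a * det (suc n) (withTopRow M (R a)))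
det-withTopRow-sum n M {zero}  w R = det-withTopRow-0 n M
det-withTopRow-sum n M {suc m} w R = begin
  det _ (withTopRow M (λ b → w zero * R zero b + rest b))
    ≡⟨ det-withTopRow-+ n M (λ b → w zero * R zero b) rest ⟩
  det _ (withTopRow M (λ b → w zero * R zero b)) + det _ (withTopRow M rest)
    ≡⟨ cong₂ _+_ (det-withTopRow-* n M (w zero) (R zero)) (det-withTopRow-sum n M (w ∘ suc) (R ∘ suc)) ⟩
  w zero * det _ (withTopRow M (R zero)) + sumℤ (λ a → w (suc a) * det _ (withTopRow M (R (suc a)))) ∎
  where
  open ≡-Reasoning
  rest : Fin (suc n) → ℤ
  rest b = sumℤ (λ a → w (suc a) * R (suc a) b)

i*j≡0⇒j≡0 : ∀ {i j : ℤ} → i ≢ 0ℤ → i * j ≡ 0ℤ → j ≡ 0ℤ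
i*j≡0⇒j≡0 {i} i≢0 ij≡0 = [ ⊥-elim ∘ i≢0 , id ]′ (ℤ.i*j≡0⇒i≡0∨j≡0 i ij≡0)

det-dependentTopRow : ∀ n (M : Matrix (suc n) (suc n)) (c : Fin (suc n) → ℤ) → c zero ≢ 0ℤ →
                      (∀ b → sumℤ (λ a → c a * M a b) ≡ 0ℤ) → det (suc n) M ≡ 0ℤ
det-dependentTopRow n M c c₀≢0 combination≡0 = i*j≡0⇒j≡0 c₀≢0 (begin
  c zero * det _ M
    ≡⟨ cong (c zero *_) (det-cong _ M≗withTop) ⟨ trans ⟩ sym (ℤ.+-identityʳ _) ⟩
  c zero * det _ (withRow zero) + 0ℤ
    ≡⟨ cong (_+_ (c zero * det _ (withRow zero))) (sym (sumℤ-zero lowerTerm≡0)) ⟩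
  sumℤ (λ a → c a * det _ (withRow a))
    ≡⟨ sym (det-withTopRow-sum n M c M) ⟩
  det _ (withTopRow M (λ b → sumℤ (λ a → c a * M a b)))
    ≡⟨ det-cong _ topRow≡0 ⟩
  det _ (withTopRow M (λ _ → 0ℤ))
    ≡⟨ det-withTopRow-0 n M ⟩
  0ℤ ∎)
  where
  open ≡-Reasoning
  withRow : Fin (suc n) → Matrix (suc n) (suc n)
  withRow a = withTopRow M (M a)
  M≗withTop : ∀ a b → M a b ≡ withRow zero a b
  M≗withTop zero    b = refl
  M≗withTop (suc a) b = refl
  lowerTerm≡0 : ∀ a → c (suc a) * det _ (withRow (suc a)) ≡ 0ℤ
  lowerTerm≡0 a = cong (c (suc a) *_) (det-equalRows _ (withRow (suc a)) {zero} {suc a} (λ ()) (λ b → refl))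
                  ⟨ trans ⟩ ℤ.*-zeroʳ (c (suc a))
  topRow≡0 : ∀ a b → withTopRow M (λ b → sumℤ (λ a → c a * M a b)) a b ≡ withTopRow M (λ _ → 0ℤ) a b
  topRow≡0 zero    b = combination≡0 b
  topRow≡0 (suc a) b = refl

det-dependentRows : ∀ n (M : Matrix (suc n) (suc n)) (c : Fin (suc n) → ℤ) p → c p ≢ 0ℤ →
                    (∀ b → sumℤ (λ a → c a * M a b) ≡ 0ℤ) → det (suc n) M ≡ 0ℤ
det-dependentRows n M c p cₚ≢0 combination≡0 = begin
  det _ M                          ≡⟨ sgn*x≡y⇒x≡sgn*y p (sym (det-moveToTop n M p)) ⟩
  sgn p * det _ (M ∘ moveToTop p)
    ≡⟨ cong (sgn p *_) (det-dependentTopRow n (M ∘ moveToTop p) (c ∘ moveToTop p) cₚ≢0 permuted≡0) ⟩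
  sgn p * 0ℤ                       ≡⟨ ℤ.*-zeroʳ (sgn p) ⟩
  0ℤ                               ∎
  where
  open ≡-Reasoning
  permuted≡0 : ∀ b → sumℤ (λ a → c (moveToTop p a) * M (moveToTop p a) b) ≡ 0ℤ
  permuted≡0 b = trans (sym (sumℤ-remove (λ a → c a * M a b) p)) (combination≡0 b)

det-addRowMultiple : ∀ n (M N : Matrix n n) {p q} (c : ℤ) → p ≢ q →
                     (∀ b → N q b ≡ M q b + c * M p b) → (∀ a b → a ≢ q → N a b ≡ M a b) → det n N ≡ det n M
det-addRowMultiple (suc n) M N {p} {q} c p≢q rowq others = begin
  det _ N                                     ≡⟨ sgn*x≡y⇒x≡sgn*y q (sym (det-moveToTop n N q)) ⟩
  sgn q * det _ (N ∘ moveToTop q)             ≡⟨ cong (sgn q *_) (det-cong _ N≗withTop) ⟩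
  sgn q * det _ (withTopRow Y (λ b → M q b + c * M p b))
    ≡⟨ cong (sgn q *_) (det-withTopRow-+ n Y (M q) (λ b → c * M p b)) ⟩
  sgn q * (det _ (withTopRow Y (M q)) + det _ (withTopRow Y (λ b → c * M p b)))
    ≡⟨ cong (λ z → sgn q * (det _ (withTopRow Y (M q)) + z)) (det-withTopRow-* n Y c (M p)) ⟩
  sgn q * (det _ (withTopRow Y (M q)) + c * det _ (withTopRow Y (M p)))
    ≡⟨ cong₂ (λ x y → sgn q * (x + c * y)) (det-cong _ withTop≗Y) pRepeated ⟩
  sgn q * (det _ Y + c * 0ℤ)                  ≡⟨ cong (λ z → sgn q * (det _ Y + z)) (ℤ.*-zeroʳ c) ⟩
  sgn q * (det _ Y + 0ℤ)                      ≡⟨ cong (sgn q *_) (ℤ.+-identityʳ _) ⟩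
  sgn q * det _ Y                             ≡⟨ cong (sgn q *_) (det-moveToTop n M q) ⟩
  sgn q * (sgn q * det _ M)                   ≡⟨ sgn*sgn*x≡x q (det _ M) ⟩
  det _ M                                     ∎
  where
  open ≡-Reasoning
  Y : Matrix (suc n) (suc n)
  Y = M ∘ moveToTop q
  N≗withTop : ∀ a b → N (moveToTop q a) b ≡ withTopRow Y (λ b → M q b + c * M p b) a b
  N≗withTop zero    b = rowq b
  N≗withTop (suc a) b = others (punchIn q a) b (punchInᵢ≢i q a)
  withTop≗Y : ∀ a b → withTopRow Y (M q) a b ≡ Y a b
  withTop≗Y zero    b = refl
  withTop≗Y (suc a) b = refl
  q≢p : q ≢ p
  q≢p = p≢q ∘ sym
  pRepeated : det (suc n) (withTopRow Y (M p)) ≡ 0ℤ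
  pRepeated = det-equalRows _ (withTopRow Y (M p)) {zero} {suc (punchOut q≢p)} (λ ())
                (λ b → cong (λ r → M r b) (sym (punchIn-punchOut q≢p)))

-- Determinants with values in {-1, 0, 1}

UnitOrZero : ℤ → Set
UnitOrZero z = z ≡ -1ℤ ⊎ z ≡ 0ℤ ⊎ z ≡ 1ℤ

UnitOrZero-0 : UnitOrZero 0ℤ
UnitOrZero-0 = inj₂ (inj₁ refl)

UnitOrZero-neg : ∀ {x} → UnitOrZero x → UnitOrZero (- x)
UnitOrZero-neg (inj₁ refl)        = inj₂ (inj₂ refl)
UnitOrZero-neg (inj₂ (inj₁ refl)) = inj₂ (inj₁ refl)
UnitOrZero-neg (inj₂ (inj₂ refl)) = inj₁ refl

UnitOrZero-* : ∀ {x y} → UnitOrZero x → UnitOrZero y → UnitOrZero (x * y)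
UnitOrZero-* {y = y} (inj₁ refl) uy = subst UnitOrZero (sym (ℤ.-1*i≡-i y)) (UnitOrZero-neg uy)
UnitOrZero-* (inj₂ (inj₁ refl)) _  = UnitOrZero-0
UnitOrZero-* {y = y} (inj₂ (inj₂ refl)) uy = subst UnitOrZero (sym (ℤ.*-identityˡ y)) uy

UnitOrZero-sgn : ∀ {n} (j : Fin n) → UnitOrZero (sgn j)
UnitOrZero-sgn zero    = inj₂ (inj₂ refl)
UnitOrZero-sgn (suc j) = UnitOrZero-neg (UnitOrZero-sgn j)

UnitOrZero-expansionTerm : ∀ {n} (p c : Fin n) {x d} → UnitOrZero x → UnitOrZero d →
                           UnitOrZero (sgn p * (sgn c * (x * d)))
UnitOrZero-expansionTerm p c ux ud =
  UnitOrZero-* (UnitOrZero-sgn p) (UnitOrZero-* (UnitOrZero-sgn c) (UnitOrZero-* ux ud))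

AtMostOneNonzeroOn : {I : Set} → Pred I 0ℓ → (I → ℤ) → Set
AtMostOneNonzeroOn P v = ∀ x y → P x → P y → v x ≢ 0ℤ → v y ≢ 0ℤ → x ≡ y

AtMostOneNonzero⇒pivot : ∀ {n} (v : Fin (suc n) → ℤ) → AtMostOneNonzeroOn U v →
                         ∃ λ p → ∀ a → a ≢ p → v a ≡ 0ℤ
AtMostOneNonzero⇒pivot v sparse with any? (λ a → ¬? (v a ℤ.≟ 0ℤ))
... | yes (p , vₚ≢0) = p , λ a a≢p →
  decidable-stable (v a ℤ.≟ 0ℤ) (λ vₐ≢0 → a≢p (sparse a p _ _ vₐ≢0 vₚ≢0))
... | no allZero = zero , λ a _ →
  decidable-stable (v a ℤ.≟ 0ℤ) (λ vₐ≢0 → allZero (a , vₐ≢0))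

det-sparseColumn-UnitOrZero : ∀ n (M : Matrix (suc n) (suc n)) b →
  (∀ a → UnitOrZero (M a b)) → AtMostOneNonzeroOn U (λ a → M a b) →
  (∀ p → UnitOrZero (det n (minor M p b))) → UnitOrZero (det (suc n) M)
det-sparseColumn-UnitOrZero n M b entries sparse minors =
  let p , others≡0 = AtMostOneNonzero⇒pivot (λ a → M a b) sparse
  in subst UnitOrZero (sym (det-expandColumn n M p b others≡0))
           (UnitOrZero-expansionTerm p b (entries p) (minors p))

det-sparseRow-UnitOrZero : ∀ n (M : Matrix (suc n) (suc n)) p →
  (∀ b → UnitOrZero (M p b)) → AtMostOneNonzeroOn U (M p) →
  (∀ b → UnitOrZero (det n (minor M p b))) → UnitOrZero (det (suc n) M)
det-sparseRow-UnitOrZero n M p entries sparse minors =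
  let b , others≡0 = AtMostOneNonzero⇒pivot (M p) sparse
  in subst UnitOrZero (sym (det-expandRow n M p b others≡0))
           (UnitOrZero-expansionTerm p b (entries b) (minors b))

signOf : Bool → ℤ
signOf true  = 1ℤ
signOf false = -1ℤ

signOf≢0 : ∀ s → signOf s ≢ 0ℤ
signOf≢0 true  ()
signOf≢0 false ()

signOf-opposite : ∀ {s t} → s ≢ t → signOf s + signOf t ≡ 0ℤ
signOf-opposite {true}  {true}  s≢t = ⊥-elim (s≢t refl)
signOf-opposite {true}  {false} _   = refl
signOf-opposite {false} {true}  _   = refl
signOf-opposite {false} {false} s≢t = ⊥-elim (s≢t refl)

≢⇒≡-either : ∀ {s t : Bool} → s ≢ t → ∀ r → r ≡ s ⊎ r ≡ t
≢⇒≡-either {true}  {true}  s≢t _     = ⊥-elim (s≢t refl)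
≢⇒≡-either {true}  {false} _   true  = inj₁ refl
≢⇒≡-either {true}  {false} _   false = inj₂ refl
≢⇒≡-either {false} {true}  _   true  = inj₂ refl
≢⇒≡-either {false} {true}  _   false = inj₁ refl
≢⇒≡-either {false} {false} s≢t _     = ⊥-elim (s≢t refl)

TwoNonzeros : ∀ {n} → (Fin n → ℤ) → Set
TwoNonzeros v = ∃ λ a → ∃ λ a′ → a ≢ a′ × v a ≢ 0ℤ × v a′ ≢ 0ℤ

twoNonzeros? : ∀ {n} (v : Fin n → ℤ) → Dec (TwoNonzeros v)
twoNonzeros? v = any? λ a → any? λ a′ → ¬? (a ≟ a′) ×-dec ¬? (v a ℤ.≟ 0ℤ) ×-dec ¬? (v a′ ℤ.≟ 0ℤ)

¬TwoNonzeros⇒AtMostOneNonzero : ∀ {n} {v : Fin n → ℤ} → ¬ TwoNonzeros v → AtMostOneNonzeroOn U v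
¬TwoNonzeros⇒AtMostOneNonzero ¬two a a′ _ _ vₐ≢0 vₐ′≢0 =
  decidable-stable (a ≟ a′) (λ a≢a′ → ¬two (a , a′ , a≢a′ , vₐ≢0 , vₐ′≢0))

module _ {n} (M : Matrix n n) (colour : Fin n → Bool)
         (entry01 : ∀ a b → M a b ≡ 0ℤ ⊎ M a b ≡ 1ℤ)
         (proper : ∀ b a a′ → M a b ≢ 0ℤ → M a′ b ≢ 0ℤ → colour a ≡ colour a′ → a ≡ a′) where

  nonzero⇒1 : ∀ {a b} → M a b ≢ 0ℤ → M a b ≡ 1ℤ
  nonzero⇒1 {a} {b} nz = [ ⊥-elim ∘ nz , id ]′ (entry01 a b)

  signedColumnSum≡0 : ∀ b → TwoNonzeros (λ a → M a b) → sumℤ (λ a → signOf (colour a) * M a b) ≡ 0ℤ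
  signedColumnSum≡0 b (a , a′ , a≢a′ , nz , nz′) = begin
    sumℤ (λ x → signOf (colour x) * M x b)                ≡⟨ sumℤ-pair _ a≢a′ others≡0 ⟩
    signOf (colour a) * M a b + signOf (colour a′) * M a′ b
      ≡⟨ cong₂ (λ x y → signOf (colour a) * x + signOf (colour a′) * y) (nonzero⇒1 nz) (nonzero⇒1 nz′) ⟩
    signOf (colour a) * 1ℤ + signOf (colour a′) * 1ℤ
      ≡⟨ cong₂ _+_ (ℤ.*-identityʳ (signOf (colour a))) (ℤ.*-identityʳ (signOf (colour a′))) ⟩
    signOf (colour a) + signOf (colour a′)
      ≡⟨ signOf-opposite colours≢ ⟩
    0ℤ ∎
    where
    open ≡-Reasoning
    colours≢ : colour a ≢ colour a′
    colours≢ same = a≢a′ (proper b a a′ nz nz′ same)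
    others≡0 : ∀ x → x ≢ a → x ≢ a′ → signOf (colour x) * M x b ≡ 0ℤ
    others≡0 x x≢a x≢a′ = trans (cong (signOf (colour x) *_) Mxb≡0) (ℤ.*-zeroʳ (signOf (colour x)))
      where
      Mxb≡0 : M x b ≡ 0ℤ
      Mxb≡0 = decidable-stable (M x b ℤ.≟ 0ℤ) λ nzₓ →
        [ x≢a ∘ proper b x a nzₓ nz , x≢a′ ∘ proper b x a′ nzₓ nz′ ]′ (≢⇒≡-either colours≢ (colour x))

det-bipartite-UnitOrZero : ∀ n (M : Matrix n n) (colour : Fin n → Bool) →
  (∀ a b → M a b ≡ 0ℤ ⊎ M a b ≡ 1ℤ) →
  (∀ b a a′ → M a b ≢ 0ℤ → M a′ b ≢ 0ℤ → colour a ≡ colour a′ → a ≡ a′) →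
  UnitOrZero (det n M)
det-bipartite-UnitOrZero zero    M colour entry01 proper = inj₂ (inj₂ refl)
det-bipartite-UnitOrZero (suc n) M colour entry01 proper with any? (λ b → ¬? (twoNonzeros? (λ a → M a b)))
... | yes (b , ¬two) =
  det-sparseColumn-UnitOrZero n M b (λ a → inj₂ (entry01 a b)) (¬TwoNonzeros⇒AtMostOneNonzero ¬two) λ p →
    det-bipartite-UnitOrZero n (minor M p b) (colour ∘ punchIn p) (λ _ _ → entry01 _ _)
      (λ _ a a′ nz nz′ same → punchIn-injective p a a′ (proper _ _ _ nz nz′ same))
... | no everyColumnTwo = inj₂ (inj₁ (det-dependentRows n M (signOf ∘ colour) zero (signOf≢0 (colour zero)) λ b →
  signedColumnSum≡0 M colour entry01 proper b
    (decidable-stable (twoNonzeros? (λ a → M a b)) (λ ¬two → everyColumnTwo (b , ¬two)))))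

-- Total unimodularity on subfamilies of rows and columns

TotallyUnimodularOn : {R C : Set} → Pred R 0ℓ → Pred C 0ℓ → (R → C → ℤ) → Set
TotallyUnimodularOn {R} {C} P Q A =
  ∀ n (ρ : Fin n → R) (κ : Fin n → C) → Injective _≡_ _≡_ ρ → Injective _≡_ _≡_ κ →
  (∀ a → P (ρ a)) → (∀ b → Q (κ b)) → UnitOrZero (det n (λ a b → A (ρ a) (κ b)))

∘punchIn-injective : ∀ {n} {X : Set} {f : Fin (suc n) → X} → Injective _≡_ _≡_ f →
                     ∀ p → Injective _≡_ _≡_ (f ∘ punchIn p)
∘punchIn-injective f-inj p eq = punchIn-injective p _ _ (f-inj eq)

module _ {R C : Set} {P : Pred R 0ℓ} {Q : Pred C 0ℓ} (A : R → C → ℤ) (entries : ∀ ℓ c → UnitOrZero (A ℓ c)) where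

  TotallyUnimodularOn-sparseColumns : {K : Pred C 0ℓ} → Decidable K →
    (∀ c → ¬ K c → AtMostOneNonzeroOn P (λ ℓ → A ℓ c)) →
    TotallyUnimodularOn P (Q ∩ K) A → TotallyUnimodularOn P Q A
  TotallyUnimodularOn-sparseColumns K? sparse tu zero _ _ _ _ _ _ = inj₂ (inj₂ refl)
  TotallyUnimodularOn-sparseColumns K? sparse tu (suc n) ρ κ ρ-inj κ-inj Pρ Qκ with any? (λ b → ¬? (K? (κ b)))
  ... | yes (b , ¬K) =
    det-sparseColumn-UnitOrZero n (λ a b → A (ρ a) (κ b)) b (λ a → entries (ρ a) (κ b))
      (λ a a′ _ _ nz nz′ → ρ-inj (sparse (κ b) ¬K (ρ a) (ρ a′) (Pρ a) (Pρ a′) nz nz′)) λ p →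
      TotallyUnimodularOn-sparseColumns K? sparse tu n (ρ ∘ punchIn p) (κ ∘ punchIn b)
        (∘punchIn-injective ρ-inj p) (∘punchIn-injective κ-inj b) (Pρ ∘ punchIn p) (Qκ ∘ punchIn b)
  ... | no allK = tu (suc n) ρ κ ρ-inj κ-inj Pρ λ b →
    Qκ b , decidable-stable (K? (κ b)) (λ ¬K → allK (b , ¬K))

  TotallyUnimodularOn-sparseRows : {K : Pred R 0ℓ} → Decidable K →
    (∀ ℓ → ¬ K ℓ → AtMostOneNonzeroOn Q (A ℓ)) →
    TotallyUnimodularOn (P ∩ K) Q A → TotallyUnimodularOn P Q A
  TotallyUnimodularOn-sparseRows K? sparse tu zero _ _ _ _ _ _ = inj₂ (inj₂ refl)
  TotallyUnimodularOn-sparseRows K? sparse tu (suc n) ρ κ ρ-inj κ-inj Pρ Qκ with any? (λ a → ¬? (K? (ρ a)))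
  ... | yes (p , ¬K) =
    det-sparseRow-UnitOrZero n (λ a b → A (ρ a) (κ b)) p (λ b → entries (ρ p) (κ b))
      (λ b b′ _ _ nz nz′ → κ-inj (sparse (ρ p) ¬K (κ b) (κ b′) (Qκ b) (Qκ b′) nz nz′)) λ b →
      TotallyUnimodularOn-sparseRows K? sparse tu n (ρ ∘ punchIn p) (κ ∘ punchIn b)
        (∘punchIn-injective ρ-inj p) (∘punchIn-injective κ-inj b) (Pρ ∘ punchIn p) (Qκ ∘ punchIn b)
  ... | no allK = tu (suc n) ρ κ ρ-inj κ-inj (λ a → Pρ a , decidable-stable (K? (ρ a)) (λ ¬K → allK (a , ¬K))) Qκ

TotallyUnimodularOn-reindex : {R C R′ C′ : Set} {P : Pred R 0ℓ} {Q : Pred C 0ℓ}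
  (A : R → C → ℤ) (B : R′ → C′ → ℤ) → DecidableEquality R′ →
  (f : ∀ ℓ → P ℓ → R′) (h : ∀ c → Q c → C′) →
  (∀ ℓ c (p : P ℓ) (q : Q c) → A ℓ c ≡ B (f ℓ p) (h c q)) →
  (∀ n (L : Fin n → R′) (χ : Fin n → C′) → Injective _≡_ _≡_ L → UnitOrZero (det n (λ a b → B (L a) (χ b)))) →
  TotallyUnimodularOn P Q A
TotallyUnimodularOn-reindex A B _≟′_ f h A≡B tuB n ρ κ _ _ Pρ Qκ =
  byCollision (any? λ a → any? λ a′ → ¬? (a ≟ a′) ×-dec (L a ≟′ L a′))
  where
  L : Fin n → _
  L a = f (ρ a) (Pρ a)
  χ : Fin n → _
  χ b = h (κ b) (Qκ b)
  A≡Bₐ : ∀ a b → A (ρ a) (κ b) ≡ B (L a) (χ b)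
  A≡Bₐ a b = A≡B (ρ a) (κ b) (Pρ a) (Qκ b)
  byCollision : Dec (∃ λ a → ∃ λ a′ → a ≢ a′ × L a ≡ L a′) → UnitOrZero (det n (λ a b → A (ρ a) (κ b)))
  byCollision (yes (a , a′ , a≢a′ , Lₐ≡Lₐ′)) = inj₂ (inj₁ (det-equalRows n _ a≢a′ λ b →
    trans (A≡Bₐ a b) (trans (cong (λ r → B r (χ b)) Lₐ≡Lₐ′) (sym (A≡Bₐ a′ b)))))
  byCollision (no noCollision) = subst UnitOrZero (sym (det-cong n A≡Bₐ)) (tuB n L χ L-inj)
    where
    L-inj : Injective _≡_ _≡_ L
    L-inj {a} {a′} Lₐ≡Lₐ′ = decidable-stable (a ≟ a′) (λ a≢a′ → noCollision (a , a′ , a≢a′ , Lₐ≡Lₐ′))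

TotallyUnimodularOn⇒TotallyUnimodular : ∀ {m n} {R C : Set} (A : R → C → ℤ) {row : Fin m → R} {col : Fin n → C} →
  Injective _≡_ _≡_ row → Injective _≡_ _≡_ col → TotallyUnimodularOn U U A →
  TotallyUnimodular (λ r c → A (row r) (col c))
TotallyUnimodularOn⇒TotallyUnimodular A row-inj col-inj tu r f h f-inj h-inj =
  tu r _ _ (f-inj ∘ row-inj) (h-inj ∘ col-inj) _ _

-- The fair top-k constraint matrix

δ-0or1 : ∀ {n} (i j : Fin n) → δ i j ≡ 0ℤ ⊎ δ i j ≡ 1ℤ
δ-0or1 i j with i ≟ j
... | yes _ = inj₂ refl
... | no  _ = inj₁ refl

δ-refl : ∀ {n} (i : Fin n) → δ i i ≡ 1ℤ
δ-refl i with i ≟ i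
... | yes _   = refl
... | no i≢i = ⊥-elim (i≢i refl)

δ-≢ : ∀ {n} {i j : Fin n} → i ≢ j → δ i j ≡ 0ℤ
δ-≢ {i = i} {j} i≢j with i ≟ j
... | yes i≡j = ⊥-elim (i≢j i≡j)
... | no  _   = refl

δ-nonzero : ∀ {n} {i j : Fin n} → δ i j ≢ 0ℤ → i ≡ j
δ-nonzero {i = i} {j} nz with i ≟ j
... | yes i≡j = i≡j
... | no  _   = ⊥-elim (nz refl)

does-∈-∪⁅⁆ : ∀ {n} {E : Subset n} {i i′} → i′ ≢ i → does (i′ ∈? (E ∪ ⁅ i ⁆)) ≡ does (i′ ∈? E)
does-∈-∪⁅⁆ {E = E} {i} {i′} i′≢i =
  does-⇔ (mk⇔ (fromUnion ∘ x∈p∪q⁻ E ⁅ i ⁆) (x∈p∪q⁺ ∘ inj₁)) (i′ ∈? _) (i′ ∈? E)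
  where
  fromUnion : i′ ∈ E ⊎ i′ ∈ ⁅ i ⁆ → i′ ∈ E
  fromUnion = [ id , ⊥-elim ∘ i′≢i ∘ x∈⁅y⁆⇒x≡y i ]′

module Core {d k g : ℕ} (grp : Fin d → Fin g) where

  CoreRow : Set
  CoreRow = Fin d ⊎ Fin k ⊎ Fin g

  pattern candidate i = inj₁ i
  pattern position  j = inj₂ (inj₁ j)
  pattern group     a = inj₂ (inj₂ a)

  _≟ᶜ_ : DecidableEquality CoreRow
  _≟ᶜ_ = ≡-dec _≟_ (≡-dec _≟_ _≟_)

  -- The x-part of constraints (1)-(3), with the row of each candidate i ∈ E subtracted
  -- from the row of its group.
  core : Subset d → CoreRow → Fin d × Fin k → ℤ
  core E (candidate i) (i′ , _)  = δ i i′
  core E (position j)  (_  , j′) = δ j j′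
  core E (group a)     (i′ , _)  = if does (i′ ∈? E) then 0ℤ else δ a (grp i′)

  core-0or1 : ∀ E ℓ c → core E ℓ c ≡ 0ℤ ⊎ core E ℓ c ≡ 1ℤ
  core-0or1 E (candidate i) (i′ , _)  = δ-0or1 i i′
  core-0or1 E (position j)  (_  , j′) = δ-0or1 j j′
  core-0or1 E (group a)     (i′ , _) with does (i′ ∈? E)
  ... | true  = inj₁ refl
  ... | false = δ-0or1 a (grp i′)

  core-∅ : ∀ a i j → core ∅ (group a) (i , j) ≡ δ a (grp i)
  core-∅ a i j rewrite dec-false (i ∈? ∅) ∉⊥ = refl

  Side : Subset d → Fin d → CoreRow → Set
  Side E i ℓ = ℓ ≡ candidate i ⊎ (i ∉ E × ℓ ≡ group (grp i))

  core-nonzero : ∀ E ℓ c → core E ℓ c ≢ 0ℤ → ℓ ≡ position (proj₂ c) ⊎ Side E (proj₁ c) ℓ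
  core-nonzero E (candidate i) (i′ , _)  nz = inj₂ (inj₁ (cong candidate (δ-nonzero nz)))
  core-nonzero E (position j)  (_  , j′) nz = inj₁ (cong position (δ-nonzero nz))
  core-nonzero E (group a)     (i′ , _)  nz with i′ ∈? E
  ... | yes _    = ⊥-elim (nz refl)
  ... | no i′∉E = inj₂ (inj₂ (i′∉E , cong group (δ-nonzero nz)))

  isPosition : CoreRow → Bool
  isPosition (position _) = true
  isPosition _            = false

  side-isPosition : ∀ {E i ℓ} → Side E i ℓ → isPosition ℓ ≡ false
  side-isPosition (inj₁ refl)       = refl
  side-isPosition (inj₂ (_ , refl)) = refl

  Conflict : ∀ {n} → Subset d → (Fin n → CoreRow) → Fin d → Set
  Conflict E L i = i ∉ E × (∃ λ p → L p ≡ candidate i) × (∃ λ q → L q ≡ group (grp i))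

  conflict? : ∀ {n} E (L : Fin n → CoreRow) → Decidable (Conflict E L)
  conflict? E L i = ¬? (i ∈? E) ×-dec any? (λ p → L p ≟ᶜ candidate i) ×-dec any? (λ q → L q ≟ᶜ group (grp i))

  module _ {n} (E : Subset d) (L : Fin n → CoreRow) (χ : Fin n → Fin d × Fin k) (L-inj : Injective _≡_ _≡_ L) where

    sides-coincide : ∀ {i a a′} → ¬ Conflict E L i → Side E i (L a) → Side E i (L a′) → a ≡ a′
    sides-coincide _ (inj₁ e)       (inj₁ e′)       = L-inj (trans e (sym e′))
    sides-coincide _ (inj₂ (_ , e)) (inj₂ (_ , e′)) = L-inj (trans e (sym e′))
    sides-coincide {a = a} {a′} noConflict (inj₁ e) (inj₂ (i∉E , e′)) =
      ⊥-elim (noConflict (i∉E , (a , e) , (a′ , e′)))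
    sides-coincide {a = a} {a′} noConflict (inj₂ (i∉E , e)) (inj₁ e′) =
      ⊥-elim (noConflict (i∉E , (a′ , e′) , (a , e)))

    core-bipartite : (∀ i → ¬ Conflict E L i) → ∀ b a a′ →
      core E (L a) (χ b) ≢ 0ℤ → core E (L a′) (χ b) ≢ 0ℤ → isPosition (L a) ≡ isPosition (L a′) → a ≡ a′
    core-bipartite noConflict b a a′ nz nz′ sameColour
      with core-nonzero E (L a) (χ b) nz | core-nonzero E (L a′) (χ b) nz′
    ... | inj₁ pos  | inj₁ pos′  = L-inj (trans pos (sym pos′))
    ... | inj₁ pos  | inj₂ side′ = case trans (sym (cong isPosition pos)) (trans sameColour (side-isPosition side′)) of λ ()
    ... | inj₂ side | inj₁ pos′  = case trans (sym (cong isPosition pos′)) (trans (sym sameColour) (side-isPosition side)) of λ ()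
    ... | inj₂ side | inj₂ side′ = sides-coincide (noConflict (proj₁ (χ b))) side side′

  i∈E∪⁅i⁆ : ∀ {E : Subset d} i → i ∈ (E ∪ ⁅ i ⁆)
  i∈E∪⁅i⁆ i = x∈p∪q⁺ (inj₂ (x∈⁅x⁆ i))

  core-maskGroup : ∀ {E i} → i ∉ E → ∀ c →
    core (E ∪ ⁅ i ⁆) (group (grp i)) c ≡ core E (group (grp i)) c + -1ℤ * core E (candidate i) c
  core-maskGroup {E} {i} i∉E (i′ , _) with i′ ≟ i
  ... | yes refl rewrite dec-true (i ∈? (E ∪ ⁅ i ⁆)) (i∈E∪⁅i⁆ i) | dec-false (i ∈? E) i∉E
                       | δ-refl (grp i) | δ-refl i = refl
  ... | no i′≢i rewrite does-∈-∪⁅⁆ {E = E} i′≢i | δ-≢ (i′≢i ∘ sym) = sym (ℤ.+-identityʳ _)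

  core-maskOther : ∀ {E i} → i ∉ E → ∀ ℓ c → ℓ ≢ group (grp i) → core (E ∪ ⁅ i ⁆) ℓ c ≡ core E ℓ c
  core-maskOther _ (candidate _) _ _ = refl
  core-maskOther _ (position _)  _ _ = refl
  core-maskOther {E} {i} i∉E (group a) (i′ , _) ℓ≢ with i′ ≟ i
  ... | yes refl rewrite dec-true (i ∈? (E ∪ ⁅ i ⁆)) (i∈E∪⁅i⁆ i) | dec-false (i ∈? E) i∉E
    = sym (δ-≢ (ℓ≢ ∘ cong group))
  ... | no i′≢i rewrite does-∈-∪⁅⁆ {E = E} i′≢i = refl

  det-mask : ∀ {n} E (L : Fin n → CoreRow) (χ : Fin n → Fin d × Fin k) → Injective _≡_ _≡_ L →
    ∀ {i} → Conflict E L i →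
    det n (λ a b → core (E ∪ ⁅ i ⁆) (L a) (χ b)) ≡ det n (λ a b → core E (L a) (χ b))
  det-mask {n} E L χ L-inj {i} (i∉E , (p , Lₚ) , (q , L_q)) =
    det-addRowMultiple n (λ a b → core E (L a) (χ b)) (λ a b → core (E ∪ ⁅ i ⁆) (L a) (χ b)) -1ℤ p≢q rowq others
    where
    p≢q : p ≢ q
    p≢q refl = case trans (sym Lₚ) L_q of λ ()
    rowq : ∀ b → core (E ∪ ⁅ i ⁆) (L q) (χ b) ≡ core E (L q) (χ b) + -1ℤ * core E (L p) (χ b)
    rowq b rewrite Lₚ | L_q = core-maskGroup i∉E (χ b)
    others : ∀ a b → a ≢ q → core (E ∪ ⁅ i ⁆) (L a) (χ b) ≡ core E (L a) (χ b)
    others a b a≢q = core-maskOther i∉E (L a) (χ b) (λ Lₐ≡ → a≢q (L-inj (trans Lₐ≡ (sym L_q))))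

  E⊂E∪⁅i⁆ : ∀ {E : Subset d} {i} → i ∉ E → (E ∪ ⁅ i ⁆) ⊃ E
  E⊂E∪⁅i⁆ {E} {i} i∉E = p⊆p∪q ⁅ i ⁆ , i , i∈E∪⁅i⁆ i , i∉E

  core-UnitOrZero : ∀ {n} (L : Fin n → CoreRow) (χ : Fin n → Fin d × Fin k) → Injective _≡_ _≡_ L →
    ∀ E → Acc _⊃_ E → UnitOrZero (det n (λ a b → core E (L a) (χ b)))
  core-UnitOrZero L χ L-inj E (acc larger) with any? (conflict? E L)
  ... | yes (i , conflict@(i∉E , _)) =
    subst UnitOrZero (det-mask E L χ L-inj conflict)
      (core-UnitOrZero L χ L-inj (E ∪ ⁅ i ⁆) (larger (E⊂E∪⁅i⁆ i∉E)))
  ... | no noConflict =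
    det-bipartite-UnitOrZero _ _ (isPosition ∘ L) (λ a b → core-0or1 E (L a) (χ b))
      (core-bipartite E L χ L-inj (λ i conflict → noConflict (i , conflict)))

  core∅-UnitOrZero : ∀ n (L : Fin n → CoreRow) (χ : Fin n → Fin d × Fin k) → Injective _≡_ _≡_ L →
    UnitOrZero (det n (λ a b → core ∅ (L a) (χ b)))
  core∅-UnitOrZero n L χ L-inj = core-UnitOrZero L χ L-inj ∅ (⊃-wellFounded ∅)

owner⇒AtMostOneNonzero : {I : Set} {P : Pred I 0ℓ} {v : I → ℤ} (o : I) →
                         (∀ x → v x ≢ 0ℤ → x ≡ o) → AtMostOneNonzeroOn P v
owner⇒AtMostOneNonzero o owner x y _ _ vₓ≢0 vᵧ≢0 = trans (owner x vₓ≢0) (sym (owner y vᵧ≢0))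

module FairTopK {d k g : ℕ} (grp : Fin d → Fin g) where
  open Core {d} {k} {g} grp

  data IsX : Pred (Col d k g) 0ℓ where
    isX : ∀ i j → IsX (xC i j)

  isX? : Decidable IsX
  isX? (xC i j) = yes (isX i j)
  isX? (sC _)   = no λ ()
  isX? (uC _)   = no λ ()
  isX? (vC _)   = no λ ()
  isX? (tC _)   = no λ ()

  data IsCoreRow : Pred (Row d k g) 0ℓ where
    row₁ : ∀ i → IsCoreRow (r1 i)
    row₂ : ∀ j → IsCoreRow (r2 j)
    row₃ : ∀ a → IsCoreRow (r3 a)
    row₄ : ∀ a → IsCoreRow (r4 a)

  isCoreRow? : Decidable IsCoreRow
  isCoreRow? (r1 i) = yes (row₁ i)
  isCoreRow? (r2 j) = yes (row₂ j)
  isCoreRow? (r3 a) = yes (row₃ a)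
  isCoreRow? (r4 a) = yes (row₄ a)
  isCoreRow? (r5 _) = no λ ()

  entry-UnitOrZero : ∀ (ℓ : Row d k g) c → UnitOrZero (entry grp ℓ c)
  entry-UnitOrZero (r1 i) (xC i′ _)  = inj₂ (δ-0or1 i i′)
  entry-UnitOrZero (r1 i) (sC i′)    = inj₂ (δ-0or1 i i′)
  entry-UnitOrZero (r1 _) (uC _)     = UnitOrZero-0
  entry-UnitOrZero (r1 _) (vC _)     = UnitOrZero-0
  entry-UnitOrZero (r1 _) (tC _)     = UnitOrZero-0
  entry-UnitOrZero (r2 j) (xC _ j′)  = inj₂ (δ-0or1 j j′)
  entry-UnitOrZero (r2 _) (sC _)     = UnitOrZero-0
  entry-UnitOrZero (r2 _) (uC _)     = UnitOrZero-0
  entry-UnitOrZero (r2 _) (vC _)     = UnitOrZero-0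
  entry-UnitOrZero (r2 _) (tC _)     = UnitOrZero-0
  entry-UnitOrZero (r3 a) (xC i′ _)  = inj₂ (δ-0or1 a (grp i′))
  entry-UnitOrZero (r3 _) (sC _)     = UnitOrZero-0
  entry-UnitOrZero (r3 a) (uC a′)    = UnitOrZero-neg (inj₂ (δ-0or1 a a′))
  entry-UnitOrZero (r3 _) (vC _)     = UnitOrZero-0
  entry-UnitOrZero (r3 _) (tC _)     = UnitOrZero-0
  entry-UnitOrZero (r4 a) (xC i′ _)  = inj₂ (δ-0or1 a (grp i′))
  entry-UnitOrZero (r4 _) (sC _)     = UnitOrZero-0
  entry-UnitOrZero (r4 _) (uC _)     = UnitOrZero-0
  entry-UnitOrZero (r4 a) (vC a′)    = inj₂ (δ-0or1 a a′)
  entry-UnitOrZero (r4 _) (tC _)     = UnitOrZero-0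
  entry-UnitOrZero (r5 p) (xC i′ j′) = inj₂ (δ-0or1 p (combine i′ j′))
  entry-UnitOrZero (r5 _) (sC _)     = UnitOrZero-0
  entry-UnitOrZero (r5 _) (uC _)     = UnitOrZero-0
  entry-UnitOrZero (r5 _) (vC _)     = UnitOrZero-0
  entry-UnitOrZero (r5 p) (tC p′)    = inj₂ (δ-0or1 p p′)

  slackOwner : ∀ c → ¬ IsX c → Row d k g
  slackOwner (xC i j) ¬x = ⊥-elim (¬x (isX i j))
  slackOwner (sC i)   _  = r1 i
  slackOwner (uC a)   _  = r3 a
  slackOwner (vC a)   _  = r4 a
  slackOwner (tC p)   _  = r5 p

  slack-nonzero⇒owner : ∀ c (¬x : ¬ IsX c) (ℓ : Row d k g) → entry grp ℓ c ≢ 0ℤ → ℓ ≡ slackOwner c ¬x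
  slack-nonzero⇒owner (xC i j) ¬x _       _  = ⊥-elim (¬x (isX i j))
  slack-nonzero⇒owner (sC i)   _  (r1 i′) nz = cong r1 (δ-nonzero nz)
  slack-nonzero⇒owner (sC _)   _  (r2 _)  nz = ⊥-elim (nz refl)
  slack-nonzero⇒owner (sC _)   _  (r3 _)  nz = ⊥-elim (nz refl)
  slack-nonzero⇒owner (sC _)   _  (r4 _)  nz = ⊥-elim (nz refl)
  slack-nonzero⇒owner (sC _)   _  (r5 _)  nz = ⊥-elim (nz refl)
  slack-nonzero⇒owner (uC _)   _  (r1 _)  nz = ⊥-elim (nz refl)
  slack-nonzero⇒owner (uC _)   _  (r2 _)  nz = ⊥-elim (nz refl)
  slack-nonzero⇒owner (uC a)   _  (r3 a′) nz = cong r3 (δ-nonzero (nz ∘ cong -_))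
  slack-nonzero⇒owner (uC _)   _  (r4 _)  nz = ⊥-elim (nz refl)
  slack-nonzero⇒owner (uC _)   _  (r5 _)  nz = ⊥-elim (nz refl)
  slack-nonzero⇒owner (vC _)   _  (r1 _)  nz = ⊥-elim (nz refl)
  slack-nonzero⇒owner (vC _)   _  (r2 _)  nz = ⊥-elim (nz refl)
  slack-nonzero⇒owner (vC _)   _  (r3 _)  nz = ⊥-elim (nz refl)
  slack-nonzero⇒owner (vC a)   _  (r4 a′) nz = cong r4 (δ-nonzero nz)
  slack-nonzero⇒owner (vC _)   _  (r5 _)  nz = ⊥-elim (nz refl)
  slack-nonzero⇒owner (tC _)   _  (r1 _)  nz = ⊥-elim (nz refl)
  slack-nonzero⇒owner (tC _)   _  (r2 _)  nz = ⊥-elim (nz refl)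
  slack-nonzero⇒owner (tC _)   _  (r3 _)  nz = ⊥-elim (nz refl)
  slack-nonzero⇒owner (tC _)   _  (r4 _)  nz = ⊥-elim (nz refl)
  slack-nonzero⇒owner (tC p)   _  (r5 p′) nz = cong r5 (δ-nonzero nz)

  slackColumn-sparse : ∀ c → ¬ IsX c → AtMostOneNonzeroOn U (λ ℓ → entry grp ℓ c)
  slackColumn-sparse c ¬x = owner⇒AtMostOneNonzero (slackOwner c ¬x) (slack-nonzero⇒owner c ¬x)

  boundRow-sparse : ∀ ℓ → ¬ IsCoreRow ℓ → AtMostOneNonzeroOn (U ∩ IsX) (entry grp ℓ)
  boundRow-sparse (r1 i) ¬core = ⊥-elim (¬core (row₁ i))
  boundRow-sparse (r2 j) ¬core = ⊥-elim (¬core (row₂ j))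
  boundRow-sparse (r3 a) ¬core = ⊥-elim (¬core (row₃ a))
  boundRow-sparse (r4 a) ¬core = ⊥-elim (¬core (row₄ a))
  boundRow-sparse (r5 p) _ _ _ (_ , isX i j) (_ , isX i′ j′) nz nz′ =
    let i≡i′ , j≡j′ = combine-injective i j i′ j′ (trans (sym (δ-nonzero {i = p} nz)) (δ-nonzero {i = p} nz′))
    in cong₂ xC i≡i′ j≡j′

  -- Rows (3) and (4) of a group have the same x-part.
  toCore : ∀ ℓ → (U ∩ IsCoreRow) ℓ → CoreRow
  toCore _ (_ , row₁ i) = candidate i
  toCore _ (_ , row₂ j) = position j
  toCore _ (_ , row₃ a) = group a
  toCore _ (_ , row₄ a) = group a

  toCell : ∀ c → (U ∩ IsX) c → Fin d × Fin k
  toCell _ (_ , isX i j) = i , j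

  entry≡core : ∀ ℓ c p q → entry grp ℓ c ≡ core ∅ (toCore ℓ p) (toCell c q)
  entry≡core _ _ (_ , row₁ i) (_ , isX i′ j′) = refl
  entry≡core _ _ (_ , row₂ j) (_ , isX i′ j′) = refl
  entry≡core _ _ (_ , row₃ a) (_ , isX i′ j′) = sym (core-∅ a i′ j′)
  entry≡core _ _ (_ , row₄ a) (_ , isX i′ j′) = sym (core-∅ a i′ j′)

  entry-TotallyUnimodularOn : TotallyUnimodularOn U U (entry grp)
  entry-TotallyUnimodularOn =
    TotallyUnimodularOn-sparseColumns {P = U} {Q = U} (entry grp) entry-UnitOrZero isX? slackColumn-sparse
      (TotallyUnimodularOn-sparseRows {P = U} {Q = U ∩ IsX} (entry grp) entry-UnitOrZero isCoreRow? boundRow-sparse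
        (TotallyUnimodularOn-reindex (entry grp) (core ∅) _≟ᶜ_ toCore toCell entry≡core core∅-UnitOrZero))

module _ (d k g : ℕ) where

  encodeRow : Row d k g → Fin (nRows d k g)
  encodeRow (r1 i) = i ↑ˡ _
  encodeRow (r2 j) = d ↑ʳ (j ↑ˡ _)
  encodeRow (r3 a) = d ↑ʳ (k ↑ʳ (a ↑ˡ _))
  encodeRow (r4 a) = d ↑ʳ (k ↑ʳ (g ↑ʳ (a ↑ˡ _)))
  encodeRow (r5 p) = d ↑ʳ (k ↑ʳ (g ↑ʳ (g ↑ʳ p)))

  encodeRow-decodeRow : ∀ r → encodeRow (decodeRow d k g r) ≡ r
  encodeRow-decodeRow r with splitAt d r in eq₁
  ... | inj₁ i = splitAt⁻¹-↑ˡ eq₁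
  ... | inj₂ r₁ with splitAt k r₁ in eq₂
  ...   | inj₁ j rewrite splitAt⁻¹-↑ˡ eq₂ = splitAt⁻¹-↑ʳ eq₁
  ...   | inj₂ r₂ with splitAt g r₂ in eq₃
  ...     | inj₁ a rewrite splitAt⁻¹-↑ˡ eq₃ | splitAt⁻¹-↑ʳ eq₂ = splitAt⁻¹-↑ʳ eq₁
  ...     | inj₂ r₃ with splitAt g r₃ in eq₄
  ...       | inj₁ a rewrite splitAt⁻¹-↑ˡ eq₄ | splitAt⁻¹-↑ʳ eq₃ | splitAt⁻¹-↑ʳ eq₂ = splitAt⁻¹-↑ʳ eq₁
  ...       | inj₂ p rewrite splitAt⁻¹-↑ʳ eq₄ | splitAt⁻¹-↑ʳ eq₃ | splitAt⁻¹-↑ʳ eq₂ = splitAt⁻¹-↑ʳ eq₁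

  encodeCol : Col d k g → Fin (nCols d k g)
  encodeCol (xC i j) = combine i j ↑ˡ _
  encodeCol (sC i)   = (d ℕ.* k) ↑ʳ (i ↑ˡ _)
  encodeCol (uC a)   = (d ℕ.* k) ↑ʳ (d ↑ʳ (a ↑ˡ _))
  encodeCol (vC a)   = (d ℕ.* k) ↑ʳ (d ↑ʳ (g ↑ʳ (a ↑ˡ _)))
  encodeCol (tC p)   = (d ℕ.* k) ↑ʳ (d ↑ʳ (g ↑ʳ (g ↑ʳ p)))

  encodeCol-decodeCol : ∀ c → encodeCol (decodeCol d k g c) ≡ c
  encodeCol-decodeCol c with splitAt (d ℕ.* k) c in eq₁
  ... | inj₁ p = trans (cong (_↑ˡ _) (combine-remQuot {d} k p)) (splitAt⁻¹-↑ˡ eq₁)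
  encodeCol-decodeCol c | inj₂ c₁ with splitAt d c₁ in eq₂
  ... | inj₁ i rewrite splitAt⁻¹-↑ˡ eq₂ = splitAt⁻¹-↑ʳ eq₁
  ... | inj₂ c₂ with splitAt g c₂ in eq₃
  ...   | inj₁ a rewrite splitAt⁻¹-↑ˡ eq₃ | splitAt⁻¹-↑ʳ eq₂ = splitAt⁻¹-↑ʳ eq₁
  ...   | inj₂ c₃ with splitAt g c₃ in eq₄
  ...     | inj₁ a rewrite splitAt⁻¹-↑ˡ eq₄ | splitAt⁻¹-↑ʳ eq₃ | splitAt⁻¹-↑ʳ eq₂ = splitAt⁻¹-↑ʳ eq₁
  ...     | inj₂ p rewrite splitAt⁻¹-↑ʳ eq₄ | splitAt⁻¹-↑ʳ eq₃ | splitAt⁻¹-↑ʳ eq₂ = splitAt⁻¹-↑ʳ eq₁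

  decodeRow-injective : Injective _≡_ _≡_ (decodeRow d k g)
  decodeRow-injective {r} {r′} eq = trans (sym (encodeRow-decodeRow r)) (trans (cong encodeRow eq) (encodeRow-decodeRow r′))

  decodeCol-injective : Injective _≡_ _≡_ (decodeCol d k g)
  decodeCol-injective {c} {c′} eq = trans (sym (encodeCol-decodeCol c)) (trans (cong encodeCol eq) (encodeCol-decodeCol c′))

lemma3p4 : (d : ℕ) (S : Pred (Permutation′ d) 0ℓ) (g : ℕ) (grp : Fin d → Fin g)
           → (∀ (a : Fin g) → ∃ λ (i : Fin d) → grp i ≡ a)
           → (α β : Fin g → ℚ)
           → (∀ a → 0ℚ ≤ℚ α a) → (∀ a → α a ≤ℚ 1ℚ)
           → (∀ a → 0ℚ ≤ℚ β a) → (∀ a → β a ≤ℚ 1ℚ)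
           → (k : ℕ) → 1 ≤ k → k ≤ d
           → TotallyUnimodular (fairTopKMatrix d k g grp)
-- No hypothesis is needed: S, α, β and the bounds on k only affect b̄, and A is totally
-- unimodular for every grouping grp.
lemma3p4 d _ g grp _ _ _ _ _ _ _ k _ _ =
  TotallyUnimodularOn⇒TotallyUnimodular (entry grp) (decodeRow-injective d k g) (decodeCol-injective d k g)
    (FairTopK.entry-TotallyUnimodularOn grp)
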